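{- Let $\mathcal{F}\subseteq\{0',1,{}^{ -1},{}^{c},\pi,\bar\pi,-,/,\backslash\}$ contain ${}^{c}$ or $-$, let $k$ be a natural number and let $\mathbf{G}_1=(G_1,a_1,b_1)$ be a marked structure. Then there exists an expression $e\in\mathcal{C}(\mathcal{F})_k$ such that for every structure $G_2$, $$e(G_2)=\{(a_2,b_2)\in\mathrm{paths}^{\mathcal{F}}_k(G_2)\mid \mathbf{G}_1 \text{ and } (G_2,a_2,b_2)\text{ are }(\mathcal{F},k)\text{ -bisimilar}\}.$$
   Context: Fix a finite set $\Lambda$ of relation names. A structure is $G=(V,(R^G)_{R\in\Lambda})$ with each $R^G\subseteq V\times V$ ($V$ possibly infinite). Expressions are built from relation names and constants $0,1,0',1'$ using $\cup,\cap,\circ,-,/,\backslash,{}^c,{}^{ -1},\pi_1,\pi_2,\bar\pi_1,\bar\pi_2$, with semantics on $G$ (node set $V$): $R(G)=R^G$, $0(G)=\emptyset$, $1(G)=V^2$, $0'(G)=\{(s,t)\in V^2:s\ne t\}$, $1'(G)=\{(s,s):s\in V\}$; set operations for $\cup,\cap,-$; $e^c(G)=V^2\setminus e(G)$; $(e_1\circ e_2)(G)=\{(s,t):\exists v\,((s,v)\in e_1(G)\wedge(v,t)\in e_2(G))\}$; $e^{ -1}(G)=\{(s,t):(t,s)\in e(G)\}$; $\pi_1(e)(G)=\{(s,s):\exists t\,(s,t)\in e(G)\}$, $\pi_2(e)(G)=\{(s,s):\exists t\,(t,s)\in e(G)\}$; $\bar\pi_1(e)(G)=\{(s,s):s\in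 V,\neg\exists t\,(s,t)\in e(G)\}$, $\bar\pi_2(e)(G)=\{(s,s):s\in V,\neg\exists t\,(t,s)\in e(G)\}$; $(e_1/e_2)(G)=\{(s,t)\in V^2:\forall v((t,v)\in e_2(G)\to(s,v)\in e_1(G))\}$; $(e_1\backslash e_2)(G)=\{(s,t)\in V^2:\forall v((v,s)\in e_1(G)\to(v,t)\in e_2(G))\}$. $\mathcal{C}(\mathcal{F})$: expressions built from relation names, $0$, $1'$, constants in $\mathcal{F}$ using $\circ,\cup,\cap$ and operations in $\mathcal{F}$ ($\pi$ = both projections, $\bar\pi$ = both coprojections). Degree: atoms/constants $0$; $\cup,\cap,-$: max; ${}^c,{}^{ -1}$: unchanged; $\circ,/,\backslash$: $1+\max$; $\pi_i,\bar\pi_i$: $+1$. $\mathcal{C}(\mathcal{F})_k$: degree $\le k$. $\mathrm{paths}^{\mathcal{F}}_k(G)$: let $E_G=\bigcup_R R^G$; $\mathrm{paths}_k(G)$ = pairs joined by a directed path of length $\le 2^k$ (length $0$ allowed), $\mathrm{upaths}_k(G)$ = same in the undirected version. 1 is present at degree 0 if $\mathcal{F}$ contains $1,0'$ or ${}^c$; at degree 1 if not at degree 0 and $\mathcal{F}$ contains $/$ or $\backslash$; absent otherwise. If absent: $\mathrm{paths}^{\mathcal{F}}_k(G)=\mathrm{paths}_k(G)$ if ${}^{ -1}\notin\mathcal{F}$, $=\mathrm{upaths}_k(G)$ if ${}^{ -1}\in\mathcal{F}$; if at degree 1: as in the absent case for $k=0$, $V^2$ for $k>0$; if at degree 0: $V^2$.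 Atomic expressions $1',0',R,R^{ -1}$; $\mathrm{aexp}(\mathcal{F})$ those in $\mathcal{C}(\mathcal{F})$; $\mathrm{atp}^{\mathcal{F}}(G,a,b)=\{e\in\mathrm{aexp}(\mathcal{F}):(a,b)\in e(G)\}$. For $Z\subseteq V_1^2\times V_2^2$, $i>0$, $P_j=\mathrm{paths}^{\mathcal{F}}_{i-1}(G_j)$, a tuple $(a_1,b_1,a_2,b_2)$ has: Atoms Forth/Back if $\mathrm{atp}^{\mathcal{F}}(G_1,a_1,b_1)\subseteq$ / $\supseteq\mathrm{atp}^{\mathcal{F}}(G_2,a_2,b_2)$; Composition Forth (w.r.t. $Z$) if for all $c_1$ with $(a_1,c_1),(c_1,b_1)\in P_1$ there is $c_2$ with $(a_1,c_1,a_2,c_2),(c_1,b_1,c_2,b_2)\in Z$; Composition Back symmetrically (for all $c_2$ with $(a_2,c_2),(c_2,b_2)\in P_2$ there is $c_1$ with the same two tuples in $Z$); Projection Forth if $a_1\ne b_1$, or $a_1=b_1$, $a_2=b_2$ and every $c_1$ with $(a_1,c_1)\in P_1$ has $c_2$ with $(a_1,c_1,a_2,c_2)\in Z$, and moreover (when $a_1=b_1$) every $c_1$ with $(c_1,a_1)\in P_1$ has $c_2$ with $(c_1,a_1,c_2,a_2)\in Z$; Projection Back the same with indices $1,2$ swapped; Left Residual Forth: every $c_2$ with $(b_2,c_2)\in P_2$ has $c_1$ with $(b_1,c_1,b_2,c_2)\in Z$ and ($(a_1,c_1)\notin P_1$ or $(a_1,c_1,a_2,c_2)\in Z$); Left Residual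 Back: every $c_1$ with $(b_1,c_1)\in P_1$ has $c_2$ with $(b_1,c_1,b_2,c_2)\in Z$ and ($(a_2,c_2)\notin P_2$ or $(a_1,c_1,a_2,c_2)\in Z$); Right Residual Forth: every $c_2$ with $(c_2,a_2)\in P_2$ has $c_1$ with $(c_1,a_1,c_2,a_2)\in Z$ and ($(c_1,b_1)\notin P_1$ or $(c_1,b_1,c_2,b_2)\in Z$); Right Residual Back: every $c_1$ with $(c_1,a_1)\in P_1$ has $c_2$ with $(c_1,a_1,c_2,a_2)\in Z$ and ($(c_2,b_2)\notin P_2$ or $(c_1,b_1,c_2,b_2)\in Z$). An $(\mathcal{F},k)$-bisimulation from $G_1$ to $G_2$ is a decreasing sequence $Z_0\supseteq\dots\supseteq Z_k$ of subsets of $V_1^2\times V_2^2$ such that all elements of $Z_0$ have Atoms Forth and Back and, for $1\le i\le k$, all elements of $Z_i$ have at degree $i$ w.r.t. $Z_{i-1}$: Composition Forth and Back; Projection Forth and Back if $\pi\in\mathcal{F}$; Left (Right) Residual Forth and Back if $/$ ($\backslash$) $\in\mathcal{F}$. Marked structures $(G_1,a_1,b_1)$, $(G_2,a_2,b_2)$ are $(\mathcal{F},k)$-bisimilar if some such sequence has $(a_1,b_1,a_2,b_2)\in Z_k$. -}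

module Defs where

open import Level using (Level; 0ℓ) renaming (suc to lsuc)
open import Data.Nat using (ℕ; zero; suc; _≤_; _<_; _^_; _⊔_)
open import Data.Fin using (Fin)
open import Data.Bool using (Bool; true; false; _∨_; if_then_else_)
open import Data.Product using (Σ; ∃; _×_; _,_)
open import Data.Sum using (_⊎_)
open import Data.Empty using (⊥)
open import Data.Unit using (⊤)
open import Relation.Nullary using (¬_)
open import Relation.Binary.PropositionalEquality using (_≡_; _≢_)

-- Optional operations / constants that a fragment F may contain.
-- π stands for both projections, π̄ for both coprojections.

data Op : Set where
  o0' o1 oinv ocompl oπ oπ̄ ominus olres orres : Op
  -- olres is "/" (left residual), orres is "\" (right residual)

Fragment : Set
Fragment = Op → Bool

_∈F_ : Op → Fragment → Set
o ∈F F = F o ≡ true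

data Exp (n : ℕ) : Set where
  rel                      : Fin n → Exp n
  `0 `1 `0' `1'            : Exp n
  union inter comp minus   : Exp n → Exp n → Exp n
  lres                     : Exp n → Exp n → Exp n
  rres                     : Exp n → Exp n → Exp n
  compl conv               : Exp n → Exp n
  proj1 proj2              : Exp n → Exp n
  coproj1 coproj2          : Exp n → Exp n

data InC {n : ℕ} (F : Fragment) : Exp n → Set where
  c-rel   : ∀ R → InC F (rel R)
  c-0     : InC F `0
  c-1'    : InC F `1'
  c-0'    : o0' ∈F F → InC F `0'
  c-1     : o1 ∈F F → InC F `1
  c-union : ∀ {e₁ e₂} → InC F e₁ → InC F e₂ → InC F (union e₁ e₂)
  c-inter : ∀ {e₁ e₂} → InC F e₁ → InC F e₂ → InC F (inter e₁ e₂)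
  c-comp  : ∀ {e₁ e₂} → InC F e₁ → InC F e₂ → InC F (comp e₁ e₂)
  c-minus : ∀ {e₁ e₂} → ominus ∈F F → InC F e₁ → InC F e₂ → InC F (minus e₁ e₂)
  c-lres  : ∀ {e₁ e₂} → olres ∈F F → InC F e₁ → InC F e₂ → InC F (lres e₁ e₂)
  c-rres  : ∀ {e₁ e₂} → orres ∈F F → InC F e₁ → InC F e₂ → InC F (rres e₁ e₂)
  c-compl : ∀ {e} → ocompl ∈F F → InC F e → InC F (compl e)
  c-conv  : ∀ {e} → oinv ∈F F → InC F e → InC F (conv e)
  c-proj1 : ∀ {e} → oπ ∈F F → InC F e → InC F (proj1 e)
  c-proj2 : ∀ {e} → oπ ∈F F → InC F e → InC F (proj2 e)
  c-coproj1 : ∀ {e} → oπ̄ ∈F F → InC F e → InC F (coproj1 e)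
  c-coproj2 : ∀ {e} → oπ̄ ∈F F → InC F e → InC F (coproj2 e)

degree : ∀ {n} → Exp n → ℕ
degree (rel _) = 0
degree `0 = 0
degree `1 = 0
degree `0' = 0
degree `1' = 0
degree (union e₁ e₂) = degree e₁ ⊔ degree e₂
degree (inter e₁ e₂) = degree e₁ ⊔ degree e₂
degree (minus e₁ e₂) = degree e₁ ⊔ degree e₂
degree (comp e₁ e₂) = suc (degree e₁ ⊔ degree e₂)
degree (lres e₁ e₂) = suc (degree e₁ ⊔ degree e₂)
degree (rres e₁ e₂) = suc (degree e₁ ⊔ degree e₂)
degree (compl e) = degree e
degree (conv e) = degree e
degree (proj1 e) = suc (degree e)
degree (proj2 e) = suc (degree e)
degree (coproj1 e) = suc (degree e)
degree (coproj2 e) = suc (degree e)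

record Structure (n : ℕ) : Set₁ where
  field
    V    : Set
    rels : Fin n → V → V → Set
open Structure public

Rel₂ : Set → Set₁
Rel₂ A = A → A → Set

⟦_⟧ : ∀ {n} → Exp n → (G : Structure n) → Rel₂ (V G)
⟦ rel R ⟧ G s t = rels G R s t
⟦ `0 ⟧ G s t = ⊥
⟦ `1 ⟧ G s t = ⊤
⟦ `0' ⟧ G s t = s ≢ t
⟦ `1' ⟧ G s t = s ≡ t
⟦ union e₁ e₂ ⟧ G s t = ⟦ e₁ ⟧ G s t ⊎ ⟦ e₂ ⟧ G s t
⟦ inter e₁ e₂ ⟧ G s t = ⟦ e₁ ⟧ G s t × ⟦ e₂ ⟧ G s t
⟦ minus e₁ e₂ ⟧ G s t = ⟦ e₁ ⟧ G s t × ¬ ⟦ e₂ ⟧ G s t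
⟦ comp e₁ e₂ ⟧ G s t = ∃ λ v → ⟦ e₁ ⟧ G s v × ⟦ e₂ ⟧ G v t
⟦ lres e₁ e₂ ⟧ G s t = ∀ v → ⟦ e₂ ⟧ G t v → ⟦ e₁ ⟧ G s v
⟦ rres e₁ e₂ ⟧ G s t = ∀ v → ⟦ e₁ ⟧ G v s → ⟦ e₂ ⟧ G v t
⟦ compl e ⟧ G s t = ¬ ⟦ e ⟧ G s t
⟦ conv e ⟧ G s t = ⟦ e ⟧ G t s
⟦ proj1 e ⟧ G s t = s ≡ t × ∃ λ u → ⟦ e ⟧ G s u
⟦ proj2 e ⟧ G s t = s ≡ t × ∃ λ u → ⟦ e ⟧ G u s
⟦ coproj1 e ⟧ G s t = s ≡ t × ¬ (∃ λ u → ⟦ e ⟧ G s u)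
⟦ coproj2 e ⟧ G s t = s ≡ t × ¬ (∃ λ u → ⟦ e ⟧ G u s)

Edge : ∀ {n} (G : Structure n) → Rel₂ (V G)
Edge {n} G s t = Σ (Fin n) λ R → rels G R s t

data Walk {A : Set} (E : Rel₂ A) : ℕ → A → A → Set where
  nil  : ∀ {s} → Walk E 0 s s
  cons : ∀ {m s u t} → E s u → Walk E m u t → Walk E (suc m) s t

pathsVia : ∀ {A : Set} → Rel₂ A → ℕ → Rel₂ A
pathsVia E k s t = ∃ λ m → m ≤ 2 ^ k × Walk E m s t

paths : ∀ {n} → ℕ → (G : Structure n) → Rel₂ (V G)
paths k G = pathsVia (Edge G) k

upaths : ∀ {n} → ℕ → (G : Structure n) → Rel₂ (V G)
upaths k G = pathsVia (λ s t → Edge G s t ⊎ Edge G t s) k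

-- "1 is present at degree 0": F contains 1, 0' or ᶜ
oneAt0 : Fragment → Bool
oneAt0 F = F o1 ∨ F o0' ∨ F ocompl

-- "1 is present at degree 1" (when not at degree 0): F contains / or \
oneAt1 : Fragment → Bool
oneAt1 F = F olres ∨ F orres

pathsAbsent : ∀ {n} → Fragment → ℕ → (G : Structure n) → Rel₂ (V G)
pathsAbsent F k G = if F oinv then upaths k G else paths k G

Full : ∀ {A : Set} → Rel₂ A
Full _ _ = ⊤

pathsF : ∀ {n} → Fragment → ℕ → (G : Structure n) → Rel₂ (V G)
pathsF F k G =
  if oneAt0 F then Full
  else (if oneAt1 F
        then (λ { s t → Step k s t })
        else pathsAbsent F k G)
  where
  Step : ℕ → Rel₂ (V G)
  Step zero = pathsAbsent F 0 G
  Step (suc _) = Full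

data AExp (n : ℕ) : Set where
  a1' a0'  : AExp n
  aR aRinv : Fin n → AExp n

toExp : ∀ {n} → AExp n → Exp n
toExp a1' = `1'
toExp a0' = `0'
toExp (aR R) = rel R
toExp (aRinv R) = conv (rel R)

InAexp : ∀ {n} → Fragment → AExp n → Set
InAexp F a = InC F (toExp a)

InAtp : ∀ {n} → Fragment → (G : Structure n) → V G → V G → AExp n → Set
InAtp F G a b e = InAexp F e × ⟦ toExp e ⟧ G a b

module _ {n : ℕ} (F : Fragment) (G₁ G₂ : Structure n) where

  Quad : Set₁
  Quad = V G₁ → V G₁ → V G₂ → V G₂ → Set

  AtomsForth AtomsBack : V G₁ → V G₁ → V G₂ → V G₂ → Set
  AtomsForth a₁ b₁ a₂ b₂ = ∀ e → InAtp F G₁ a₁ b₁ e → InAtp F G₂ a₂ b₂ e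
  AtomsBack  a₁ b₁ a₂ b₂ = ∀ e → InAtp F G₂ a₂ b₂ e → InAtp F G₁ a₁ b₁ e

  -- conditions for a tuple at degree i, w.r.t. Z = Z_{i-1},
  -- with P₁ = paths^F_{i-1}(G₁), P₂ = paths^F_{i-1}(G₂)
  module Conditions (Z : Quad) (P₁ : Rel₂ (V G₁)) (P₂ : Rel₂ (V G₂))
                    (a₁ b₁ : V G₁) (a₂ b₂ : V G₂) where

    CompForth CompBack : Set
    CompForth = ∀ c₁ → P₁ a₁ c₁ → P₁ c₁ b₁ →
                ∃ λ c₂ → Z a₁ c₁ a₂ c₂ × Z c₁ b₁ c₂ b₂
    CompBack  = ∀ c₂ → P₂ a₂ c₂ → P₂ c₂ b₂ →
                ∃ λ c₁ → Z a₁ c₁ a₂ c₂ × Z c₁ b₁ c₂ b₂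

    ProjForth ProjBack : Set
    ProjForth = a₁ ≢ b₁ ⊎
                (a₁ ≡ b₁ × a₂ ≡ b₂
                 × (∀ c₁ → P₁ a₁ c₁ → ∃ λ c₂ → Z a₁ c₁ a₂ c₂)
                 × (∀ c₁ → P₁ c₁ a₁ → ∃ λ c₂ → Z c₁ a₁ c₂ a₂))
    ProjBack  = a₂ ≢ b₂ ⊎
                (a₂ ≡ b₂ × a₁ ≡ b₁
                 × (∀ c₂ → P₂ a₂ c₂ → ∃ λ c₁ → Z a₁ c₁ a₂ c₂)
                 × (∀ c₂ → P₂ c₂ a₂ → ∃ λ c₁ → Z c₁ a₁ c₂ a₂))

    LResForth LResBack RResForth RResBack : Set
    LResForth = ∀ c₂ → P₂ b₂ c₂ → ∃ λ c₁ →
                Z b₁ c₁ b₂ c₂ × (¬ P₁ a₁ c₁ ⊎ Z a₁ c₁ a₂ c₂)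
    LResBack  = ∀ c₁ → P₁ b₁ c₁ → ∃ λ c₂ →
                Z b₁ c₁ b₂ c₂ × (¬ P₂ a₂ c₂ ⊎ Z a₁ c₁ a₂ c₂)
    RResForth = ∀ c₂ → P₂ c₂ a₂ → ∃ λ c₁ →
                Z c₁ a₁ c₂ a₂ × (¬ P₁ c₁ b₁ ⊎ Z c₁ b₁ c₂ b₂)
    RResBack  = ∀ c₁ → P₁ c₁ a₁ → ∃ λ c₂ →
                Z c₁ a₁ c₂ a₂ × (¬ P₂ c₂ b₂ ⊎ Z c₁ b₁ c₂ b₂)

    AllConditions : Set
    AllConditions =
      CompForth × CompBack
      × (oπ ∈F F → ProjForth × ProjBack)
      × (olres ∈F F → LResForth × LResBack)
      × (orres ∈F F → RResForth × RResBack)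

  -- (F,k)-bisimulation: Z₀ ⊇ … ⊇ Z_k  (indexed by ℕ; only indices ≤ k matter)
  record IsBisimulation (k : ℕ) (Z : ℕ → Quad) : Set₁ where
    field
      decreasing : ∀ i → i < k → ∀ a₁ b₁ a₂ b₂ → Z (suc i) a₁ b₁ a₂ b₂ → Z i a₁ b₁ a₂ b₂
      atoms      : ∀ a₁ b₁ a₂ b₂ → Z 0 a₁ b₁ a₂ b₂ →
                   AtomsForth a₁ b₁ a₂ b₂ × AtomsBack a₁ b₁ a₂ b₂
      step       : ∀ i → suc i ≤ k → ∀ a₁ b₁ a₂ b₂ → Z (suc i) a₁ b₁ a₂ b₂ →
                   Conditions.AllConditions (Z i) (pathsF F i G₁) (pathsF F i G₂) a₁ b₁ a₂ b₂

  Bisimilar : ℕ → V G₁ → V G₁ → V G₂ → V G₂ → Set₁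
  Bisimilar k a₁ b₁ a₂ b₂ =
    Σ (ℕ → Quad) λ Z → IsBisimulation k Z × Z k a₁ b₁ a₂ b₂

-- For each degree m there is a finite family of expressions of C(F)_m, invariant under
-- (F,m)-bisimilarity, whose truth values at a marked structure determine it up to
-- (F,m)-bisimilarity: at degree 0 the atomic expressions; at degree m+1 the family of
-- degree m together with the compositions, projections and residuals built from the
-- characteristic expressions of degree m.  The characteristic expression of (G₁,a₁,b₁) is
-- then the intersection, inside paths_m, of the members of the family true at (a₁,b₁) and
-- of the relative complements of those false there; ᶜ or − is what makes these relative
-- complements expressible.  Bisimilarity is handled through its recursive characterisation,
-- in which the conditions of each degree split into those challenged in G₁ and the same
-- conditions with G₁ and G₂ swapped.

module Submission where

open import Defs
open import Level using (0ℓ; lift; lower) renaming (suc to lsuc)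
open import Axiom.ExcludedMiddle using (ExcludedMiddle)
open import Data.Nat using (ℕ; zero; suc; _≤_; _+_; _^_; z≤n; s≤s)
open import Data.Nat.Properties
  using (+-identityʳ; +-mono-≤; ⊔-lub; ≤-refl; ≤-trans; <⇒≤; m≤n⇒m≤1+n)
import Data.Fin as Fin
open Fin using (Fin)
open import Data.Bool using (Bool; true; false; _∨_; if_then_else_)
open import Data.Bool.Properties using (∨-zeroʳ)
open import Data.Product using (Σ; ∃; _×_; _,_; proj₁; proj₂; uncurry; map₂)
import Data.Product as Product
open import Data.Product.Function.NonDependent.Propositional using (_×-⇔_)
open import Data.Sum using (_⊎_; inj₁; inj₂; [_,_])
import Data.Sum as Sum
open import Data.Empty using (⊥-elim)
open import Data.Unit using (tt)
open import Function using (id; _∘_)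
open import Relation.Nullary using (¬_; Dec; yes; no)
open import Relation.Nullary.Decidable using (map′; decidable-stable)
open import Relation.Unary using (Decidable)
open import Relation.Binary.PropositionalEquality using (_≡_; refl; sym; trans; cong; subst)
open import Function.Bundles using (_⇔_; mk⇔; Equivalence)
open import Function.Properties.Equivalence
  using () renaming (refl to ⇔-refl; sym to ⇔-sym; trans to ⇔-trans)
open import Data.List using (List; []; _∷_; _++_; map; concatMap; allFin; filter; cartesianProduct)
open import Data.List.Membership.Propositional using (_∈_; lose)
open import Data.List.Membership.Propositional.Properties
  using (∈-allFin; ∈-map⁺; ∈-++⁺ˡ; ∈-++⁺ʳ; ∈-concatMap⁺; ∈-filter⁺; ∈-cartesianProduct⁺)
open import Data.List.Relation.Unary.All as All using (All; []; _∷_)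
open import Data.List.Relation.Unary.All.Properties using (++⁺; ++⁻; map⁺; all-filter)
open import Data.List.Relation.Unary.Any using (here; there)

open Equivalence using (to; from)

module _ {A : Set} {E : Rel₂ A} where

  WalkWithin : ℕ → Rel₂ A
  WalkWithin p s t = ∃ λ m → m ≤ p × Walk E m s t

  walk-++ : ∀ {p q s u t} → Walk E p s u → Walk E q u t → Walk E (p + q) s t
  walk-++ nil w = w
  walk-++ (cons e w) w′ = cons e (walk-++ w w′)

  walkWithin-join : ∀ {p q s u t} → WalkWithin p s u → WalkWithin q u t → WalkWithin (p + q) s t
  walkWithin-join (m₁ , l₁ , w₁) (m₂ , l₂ , w₂) = m₁ + m₂ , +-mono-≤ l₁ l₂ , walk-++ w₁ w₂

  walkWithin-split : ∀ p {q s t} → WalkWithin (p + q) s t →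
                     ∃ λ u → WalkWithin p s u × WalkWithin q u t
  walkWithin-split zero w = _ , (0 , z≤n , nil) , w
  walkWithin-split (suc p) (zero , _ , nil) = _ , (0 , z≤n , nil) , (0 , z≤n , nil)
  walkWithin-split (suc p) (suc m , s≤s l , cons e w) =
    let u , (m₁ , l₁ , w₁) , w₂ = walkWithin-split p (m , l , w)
    in u , (suc m₁ , s≤s l₁ , cons e w₁) , w₂

  pathsVia-zero : ∀ {s t} → pathsVia E 0 s t ⇔ (s ≡ t ⊎ E s t)
  pathsVia-zero = mk⇔ walk≤1⇒ ⇒walk≤1
    where
    walk≤1⇒ : ∀ {s t} → pathsVia E 0 s t → s ≡ t ⊎ E s t
    walk≤1⇒ (zero , _ , nil) = inj₁ refl
    walk≤1⇒ (suc zero , _ , cons e nil) = inj₂ e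
    walk≤1⇒ (suc (suc _) , s≤s () , _)
    ⇒walk≤1 : ∀ {s t} → s ≡ t ⊎ E s t → pathsVia E 0 s t
    ⇒walk≤1 (inj₁ refl) = 0 , z≤n , nil
    ⇒walk≤1 (inj₂ e) = 1 , ≤-refl , cons e nil

  pathsVia-suc : ∀ {k s t} → pathsVia E (suc k) s t ⇔ (∃ λ u → pathsVia E k s u × pathsVia E k u t)
  pathsVia-suc {k} {s} {t} =
    subst (λ p → WalkWithin (2 ^ k + p) s t ⇔ (∃ λ u → pathsVia E k s u × pathsVia E k u t))
      (sym (+-identityʳ (2 ^ k)))
    (mk⇔ (walkWithin-split (2 ^ k)) (λ (_ , p , q) → walkWithin-join p q))

if-true : ∀ {a} {A : Set a} {b : Bool} {x y : A} → b ≡ true → (if b then x else y) ≡ x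
if-true refl = refl

if-false : ∀ {a} {A : Set a} {b : Bool} {x y : A} → b ≡ false → (if b then x else y) ≡ y
if-false refl = refl

module Characteristic (em : ExcludedMiddle (lsuc 0ℓ)) {n : ℕ} (F : Fragment) where

  private variable
    m k : ℕ
    e e′ χ : Exp n
    D : List (Exp n)
    G G₁ G₂ : Structure n

  dec : (P : Set) → Dec P
  dec P = map′ lower lift em

  dne : {P : Set} → ¬ ¬ P → P
  dne = decidable-stable (dec _)

  ¬∀⇒∃¬ : {A : Set} {B C : A → Set} → ¬ (∀ x → B x → C x) → ∃ λ x → B x × ¬ C x
  ¬∀⇒∃¬ h = dne λ ¬∃ → h λ x b → dne λ ¬c → ¬∃ (x , b , ¬c)

  ¬[×¬]⇒¬⊎ : {P Q : Set} → ¬ (P × ¬ Q) → ¬ P ⊎ Q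
  ¬[×¬]⇒¬⊎ {P} h with dec P
  ... | yes p = inj₂ (dne λ ¬q → h (p , ¬q))
  ... | no ¬p = inj₁ ¬p

  Link : Bool → (G : Structure n) → Rel₂ (V G)
  Link true G s t = Edge G s t ⊎ Edge G t s
  Link false G s t = Edge G s t

  pathsAbsent≡ : ∀ b {k} (G : Structure n) →
                 (if b then upaths k G else paths k G) ≡ pathsVia (Link b G) k
  pathsAbsent≡ true G = refl
  pathsAbsent≡ false G = refl

  data Regime : Set where
    one-at-0 : oneAt0 F ≡ true → Regime
    one-at-1 : oneAt0 F ≡ false → oneAt1 F ≡ true → Regime
    no-one   : oneAt0 F ≡ false → oneAt1 F ≡ false → Regime

  regime : Regime
  regime with oneAt0 F in e₀ | oneAt1 F in e₁
  ... | true  | _     = one-at-0 e₀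
  ... | false | true  = one-at-1 e₀ e₁
  ... | false | false = no-one e₀ e₁

  pathsF-one-at-0 : oneAt0 F ≡ true → ∀ m (G : Structure n) → pathsF F m G ≡ Full
  pathsF-one-at-0 e₀ _ _ = if-true e₀

  pathsF-one-at-1-zero : oneAt0 F ≡ false → oneAt1 F ≡ true →
                         ∀ (G : Structure n) → pathsF F 0 G ≡ pathsVia (Link (F oinv) G) 0
  pathsF-one-at-1-zero e₀ e₁ G =
    trans (if-false e₀) (trans (if-true e₁) (pathsAbsent≡ (F oinv) {0} G))

  pathsF-one-at-1-suc : oneAt0 F ≡ false → oneAt1 F ≡ true →
                        ∀ m (G : Structure n) → pathsF F (suc m) G ≡ Full
  pathsF-one-at-1-suc e₀ e₁ _ _ = trans (if-false e₀) (if-true e₁)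

  pathsF-no-one : oneAt0 F ≡ false → oneAt1 F ≡ false →
                  ∀ m (G : Structure n) → pathsF F m G ≡ pathsVia (Link (F oinv) G) m
  pathsF-no-one e₀ e₁ m G =
    trans (if-false e₀) (trans (if-false e₁) (pathsAbsent≡ (F oinv) {m} G))

  Full⇒ : ∀ {A : Set} {R : Rel₂ A} {s t} → R ≡ Full → R s t
  Full⇒ refl = tt

  -- The conditions of a degree > 0 in which the universally quantified node lies in G₁.
  record Challenges (G₁ G₂ : Structure n) (Z : Quad F G₁ G₂) (P₁ : Rel₂ (V G₁)) (P₂ : Rel₂ (V G₂))
                    (a₁ b₁ : V G₁) (a₂ b₂ : V G₂) : Set where
    constructor challenges
    open Conditions F G₁ G₂ Z P₁ P₂ a₁ b₁ a₂ b₂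
    field
      composition    : CompForth
      projection     : oπ ∈F F → ProjForth
      left-residual  : olres ∈F F → LResBack
      right-residual : orres ∈F F → RResBack

  module _ {Z : Quad F G₁ G₂} {P₁ : Rel₂ (V G₁)} {P₂ : Rel₂ (V G₂)} where

    Zᵀ : Quad F G₂ G₁
    Zᵀ a₂ b₂ a₁ b₁ = Z a₁ b₁ a₂ b₂

    conditions⇒challenges : ∀ {a₁ b₁ a₂ b₂} → Conditions.AllConditions F G₁ G₂ Z P₁ P₂ a₁ b₁ a₂ b₂ →
                            Challenges G₁ G₂ Z P₁ P₂ a₁ b₁ a₂ b₂ ×
                            Challenges G₂ G₁ Zᵀ P₂ P₁ a₂ b₂ a₁ b₁
    conditions⇒challenges (cf , cb , pj , lr , rr) =
      challenges cf (proj₁ ∘ pj) (proj₂ ∘ lr) (proj₂ ∘ rr) ,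
      challenges cb (proj₂ ∘ pj) (proj₁ ∘ lr) (proj₁ ∘ rr)

    challenges⇒conditions : ∀ {a₁ b₁ a₂ b₂} → Challenges G₁ G₂ Z P₁ P₂ a₁ b₁ a₂ b₂ →
                            Challenges G₂ G₁ Zᵀ P₂ P₁ a₂ b₂ a₁ b₁ →
                            Conditions.AllConditions F G₁ G₂ Z P₁ P₂ a₁ b₁ a₂ b₂
    challenges⇒conditions (challenges cf pf lb rb) (challenges cb pb lf rf) =
      cf , cb , (λ o → pf o , pb o) , (λ o → lf o , lb o) , (λ o → rf o , rb o)

    challenges-map : ∀ {Z′ : Quad F G₁ G₂} {a₁ b₁ a₂ b₂} →
                     (∀ {a₁ b₁ a₂ b₂} → Z a₁ b₁ a₂ b₂ → Z′ a₁ b₁ a₂ b₂) →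
                     Challenges G₁ G₂ Z P₁ P₂ a₁ b₁ a₂ b₂ → Challenges G₁ G₂ Z′ P₁ P₂ a₁ b₁ a₂ b₂
    challenges-map f (challenges cf pf lb rb) = challenges
      (λ c p q → let c₂ , u , v = cf c p q in c₂ , f u , f v)
      (λ o → Sum.map₂ (λ (e₁ , e₂ , g , h) → e₁ , e₂ , (λ c → map₂ f ∘ g c) , (λ c → map₂ f ∘ h c))
                      (pf o))
      (λ o c p → let c₂ , u , d = lb o c p in c₂ , f u , Sum.map₂ f d)
      (λ o c p → let c₂ , u , d = rb o c p in c₂ , f u , Sum.map₂ f d)

  challenges-refl : ∀ {P : Rel₂ (V G)} {Z : Quad F G G} {a b} → (∀ s t → Z s t s t) →
                    Challenges G G Z P P a b a b
  challenges-refl {a = a} {b = b} r = challenges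
    (λ c _ _ → c , r _ c , r c _) project
    (λ _ c _ → c , r _ c , inj₂ (r _ c)) (λ _ c _ → c , r c _ , inj₂ (r c _))
    where
    project : _ → _
    project _ with dec (a ≡ b)
    ... | yes a≡b = inj₂ (a≡b , a≡b , (λ c _ → c , r a c) , (λ c _ → c , r c a))
    ... | no a≢b = inj₁ a≢b

  projection-at : ∀ {Z : Quad F G₁ G₂} {P₁ P₂ a₁ b₁ a₂ b₂} →
                  Challenges G₁ G₂ Z P₁ P₂ a₁ b₁ a₂ b₂ → oπ ∈F F → a₁ ≡ b₁ →
                  a₂ ≡ b₂ × (∀ c₁ → P₁ a₁ c₁ → ∃ λ c₂ → Z a₁ c₁ a₂ c₂)
                          × (∀ c₁ → P₁ c₁ a₁ → ∃ λ c₂ → Z c₁ a₁ c₂ a₂)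
  projection-at cs o a₁≡b₁ with Challenges.projection cs o
  ... | inj₁ a₁≢b₁ = ⊥-elim (a₁≢b₁ a₁≡b₁)
  ... | inj₂ (_ , forth) = forth

  -- The largest (F,k)-bisimulation, by recursion on k.
  data Equivalent (G₁ G₂ : Structure n) : ℕ → V G₁ → V G₁ → V G₂ → V G₂ → Set where
    atoms : ∀ {a₁ b₁ a₂ b₂} →
            AtomsForth F G₁ G₂ a₁ b₁ a₂ b₂ → AtomsBack F G₁ G₂ a₁ b₁ a₂ b₂ →
            Equivalent G₁ G₂ 0 a₁ b₁ a₂ b₂
    step  : ∀ {k a₁ b₁ a₂ b₂} →
            Equivalent G₁ G₂ k a₁ b₁ a₂ b₂ →
            Challenges G₁ G₂ (Equivalent G₁ G₂ k) (pathsF F k G₁) (pathsF F k G₂) a₁ b₁ a₂ b₂ →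
            Challenges G₂ G₁ (Equivalent G₂ G₁ k) (pathsF F k G₂) (pathsF F k G₁) a₂ b₂ a₁ b₁ →
            Equivalent G₁ G₂ (suc k) a₁ b₁ a₂ b₂

  Equivalent-sym : ∀ {a₁ b₁ a₂ b₂} → Equivalent G₁ G₂ m a₁ b₁ a₂ b₂ → Equivalent G₂ G₁ m a₂ b₂ a₁ b₁
  Equivalent-sym (atoms forth back) = atoms back forth
  Equivalent-sym (step z left right) = step (Equivalent-sym z) right left

  Equivalent-refl : ∀ m (G : Structure n) a b → Equivalent G G m a b a b
  Equivalent-refl zero G a b = atoms (λ _ h → h) (λ _ h → h)
  Equivalent-refl (suc m) G a b = step (Equivalent-refl m G a b) refl-challenges refl-challenges
    where
    refl-challenges : Challenges G G (Equivalent G G m) (pathsF F m G) (pathsF F m G) a b a b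
    refl-challenges = challenges-refl (Equivalent-refl m G)

  Equivalent-pred : ∀ {a₁ b₁ a₂ b₂} →
                    Equivalent G₁ G₂ (suc m) a₁ b₁ a₂ b₂ → Equivalent G₁ G₂ m a₁ b₁ a₂ b₂
  Equivalent-pred (step z _ _) = z

  Equivalent⇒atoms : ∀ {a₁ b₁ a₂ b₂} →
                     Equivalent G₁ G₂ m a₁ b₁ a₂ b₂ → AtomsForth F G₁ G₂ a₁ b₁ a₂ b₂
  Equivalent⇒atoms (atoms forth _) = forth
  Equivalent⇒atoms (step z _ _) = Equivalent⇒atoms z

  Equivalent-≡ : ∀ {a₁ b₁ a₂ b₂} → Equivalent G₁ G₂ m a₁ b₁ a₂ b₂ → a₁ ≡ b₁ → a₂ ≡ b₂
  Equivalent-≡ z a₁≡b₁ = proj₂ (Equivalent⇒atoms z a1' (c-1' , a₁≡b₁))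

  module _ {G₁ G₂ : Structure n} {k : ℕ} where

    bisimulation⊆Equivalent : ∀ {Z} → IsBisimulation F G₁ G₂ k Z → ∀ i → i ≤ k →
                              ∀ {a₁ b₁ a₂ b₂} → Z i a₁ b₁ a₂ b₂ → Equivalent G₁ G₂ i a₁ b₁ a₂ b₂
    bisimulation⊆Equivalent B zero _ z = uncurry atoms (IsBisimulation.atoms B _ _ _ _ z)
    bisimulation⊆Equivalent B (suc i) i<k z =
      let left , right = conditions⇒challenges (IsBisimulation.step B i i<k _ _ _ _ z)
          below = bisimulation⊆Equivalent B i (<⇒≤ i<k)
      in step (below (IsBisimulation.decreasing B i i<k _ _ _ _ z))
              (challenges-map below left) (challenges-map (Equivalent-sym ∘ below) right)

    Equivalent-isBisimulation : IsBisimulation F G₁ G₂ k (Equivalent G₁ G₂)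
    Equivalent-isBisimulation = record
      { decreasing = λ _ _ _ _ _ _ → Equivalent-pred
      ; atoms      = λ { _ _ _ _ (atoms forth back) → forth , back }
      ; step       = λ { _ _ _ _ _ _ (step _ left right) →
                         challenges⇒conditions left (challenges-map Equivalent-sym right) }
      }

    Bisimilar⇔Equivalent : ∀ {a₁ b₁ a₂ b₂} →
                           Bisimilar F G₁ G₂ k a₁ b₁ a₂ b₂ ⇔ Equivalent G₁ G₂ k a₁ b₁ a₂ b₂
    Bisimilar⇔Equivalent = mk⇔ (λ (_ , B , z) → bisimulation⊆Equivalent B k ≤-refl z)
                               (λ z → _ , Equivalent-isBisimulation , z)

  Valid : ℕ → Exp n → Set
  Valid m e = InC F e × degree e ≤ m

  Invariant : ℕ → Exp n → Set₁
  Invariant m e = ∀ {G₁ G₂ : Structure n} {a₁ b₁ a₂ b₂} →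
                  Equivalent G₁ G₂ m a₁ b₁ a₂ b₂ → ⟦ e ⟧ G₁ a₁ b₁ → ⟦ e ⟧ G₂ a₂ b₂

  WithinPaths : ℕ → Exp n → Set₁
  WithinPaths m e = ∀ {G : Structure n} {s t} → ⟦ e ⟧ G s t → pathsF F m G s t

  Test : ℕ → Exp n → Set₁
  Test m e = Valid m e × Invariant m e

  PathTest : ℕ → Exp n → Set₁
  PathTest m e = Test m e × WithinPaths m e

  invariant-⇔ : Invariant m e → ∀ {G₁ G₂ : Structure n} {a₁ b₁ a₂ b₂} →
                Equivalent G₁ G₂ m a₁ b₁ a₂ b₂ → ⟦ e ⟧ G₁ a₁ b₁ ⇔ ⟦ e ⟧ G₂ a₂ b₂
  invariant-⇔ inv z = mk⇔ (inv z) (inv (Equivalent-sym z))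

  test-suc : Test k e → Test (suc k) e
  test-suc ((c , d) , inv) = (c , m≤n⇒m≤1+n d) , inv ∘ Equivalent-pred

  valid-weaken : ∀ {m′} → m ≤ m′ → Valid m e → Valid m′ e
  valid-weaken m≤m′ (c , d) = c , ≤-trans d m≤m′

  atom-test : ∀ {x} → InAexp F x → Test m (toExp x)
  atom-test {x = x} c = (c , degree-0 x) , λ z h → proj₂ (Equivalent⇒atoms z x (c , h))
    where
    degree-0 : ∀ x → degree (toExp {n} x) ≤ _
    degree-0 a1' = z≤n
    degree-0 a0' = z≤n
    degree-0 (aR _) = z≤n
    degree-0 (aRinv _) = z≤n

  union-test : Test m e → Test m e′ → Test m (union e e′)
  union-test ((c , d) , inv) ((c′ , d′) , inv′) =
    (c-union c c′ , ⊔-lub d d′) , λ z → Sum.map (inv z) (inv′ z)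

  inter-pathTest : Test m e → PathTest m e′ → PathTest m (inter e e′)
  inter-pathTest ((c , d) , inv) (((c′ , d′) , inv′) , within) =
    ((c-inter c c′ , ⊔-lub d d′) , λ z → Product.map (inv z) (inv′ z)) , within ∘ proj₂

  ⋃[_] : ∀ {r} → (Fin r → Exp n) → Exp n
  ⋃[_] {zero} f = `0
  ⋃[_] {suc r} f = union (f Fin.zero) ⋃[ f ∘ Fin.suc ]

  ⋃-sem : ∀ {r} (f : Fin r → Exp n) {G : Structure n} {s t} →
          ⟦ ⋃[ f ] ⟧ G s t ⇔ ∃ λ i → ⟦ f i ⟧ G s t
  ⋃-sem {zero} f = mk⇔ (λ ()) (λ ())
  ⋃-sem {suc r} f = mk⇔
    [ (λ h → Fin.zero , h) , (λ h → let i , h′ = to (⋃-sem (f ∘ Fin.suc)) h in Fin.suc i , h′) ]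
    (λ { (Fin.zero , h) → inj₁ h ; (Fin.suc i , h) → inj₂ (from (⋃-sem (f ∘ Fin.suc)) (i , h)) })

  ⋃-test : ∀ {r} {f : Fin r → Exp n} → (∀ i → Test m (f i)) → Test m ⋃[ f ]
  ⋃-test {r = zero} _ = (c-0 , z≤n) , λ _ ()
  ⋃-test {r = suc r} t = union-test (t Fin.zero) (⋃-test (t ∘ Fin.suc))

  comp-test : PathTest k e → PathTest k e′ → Test (suc k) (comp e e′)
  comp-test (((c , d) , inv) , within) (((c′ , d′) , inv′) , within′) =
    (c-comp c c′ , s≤s (⊔-lub d d′)) ,
    λ { (step _ left _) (v , h , h′) →
          let v₂ , z , z′ = Challenges.composition left v (within h) (within′ h′)
          in v₂ , inv z h , inv′ z′ h′ }

  proj1-test : oπ ∈F F → PathTest k e → Test (suc k) (proj1 e)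
  proj1-test o (((c , d) , inv) , within) =
    (c-proj1 o c , s≤s d) ,
    λ { (step _ left _) (a₁≡b₁ , v , h) →
          let a₂≡b₂ , forth , _ = projection-at left o a₁≡b₁
              v₂ , z = forth v (within h)
          in a₂≡b₂ , v₂ , inv z h }

  proj2-test : oπ ∈F F → PathTest k e → Test (suc k) (proj2 e)
  proj2-test o (((c , d) , inv) , within) =
    (c-proj2 o c , s≤s d) ,
    λ { (step _ left _) (a₁≡b₁ , v , h) →
          let a₂≡b₂ , _ , back = projection-at left o a₁≡b₁
              v₂ , z = back v (within h)
          in a₂≡b₂ , v₂ , inv z h }

  lres-test : olres ∈F F → PathTest k e → PathTest k e′ → Test (suc k) (lres e e′)
  lres-test o (((c , d) , inv) , within) (((c′ , d′) , inv′) , within′) =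
    (c-lres o c c′ , s≤s (⊔-lub d d′)) ,
    λ { (step _ _ right) h v₂ h′ →
          let v₁ , z′ , out = Challenges.left-residual right o v₂ (within′ h′)
              h₁ = h v₁ (inv′ z′ h′)
          in [ (λ ¬p → ⊥-elim (¬p (within h₁))) , (λ z → inv (Equivalent-sym z) h₁) ] out }

  rres-test : orres ∈F F → PathTest k e → PathTest k e′ → Test (suc k) (rres e e′)
  rres-test o (((c , d) , inv) , within) (((c′ , d′) , inv′) , within′) =
    (c-rres o c c′ , s≤s (⊔-lub d d′)) ,
    λ { (step _ _ right) h v₂ h₂ →
          let v₁ , z , out = Challenges.right-residual right o v₂ (within h₂)
              h′ = h v₁ (inv z h₂)
          in [ (λ ¬p → ⊥-elim (¬p (within′ h′))) , (λ z′ → inv′ (Equivalent-sym z′) h′) ] out }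

  linkExp : Bool → Fin n → Exp n
  linkExp true R = union (rel R) (conv (rel R))
  linkExp false R = rel R

  linkExp-sem : ∀ b {G : Structure n} {s t} → (∃ λ R → ⟦ linkExp b R ⟧ G s t) ⇔ Link b G s t
  linkExp-sem true = mk⇔ (λ { (R , inj₁ r) → inj₁ (R , r) ; (R , inj₂ r) → inj₂ (R , r) })
                         [ (λ (R , r) → R , inj₁ r) , (λ (R , r) → R , inj₂ r) ]
  linkExp-sem false = mk⇔ id id

  linkExp-test : ∀ {b} → F oinv ≡ b → ∀ R → Test m (linkExp b R)
  linkExp-test {b = true} inv R =
    union-test (atom-test {x = aR R} (c-rel R)) (atom-test {x = aRinv R} (c-conv inv (c-rel R)))
  linkExp-test {b = false} _ R = atom-test {x = aR R} (c-rel R)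

  walkExp : ℕ → Exp n
  walkExp zero = union `1' ⋃[ linkExp (F oinv) ]
  walkExp (suc m) = comp (walkExp m) (walkExp m)

  walkExp-sem : ∀ m {G : Structure n} {s t} → ⟦ walkExp m ⟧ G s t ⇔ pathsVia (Link (F oinv) G) m s t
  walkExp-sem zero = mk⇔
    (from pathsVia-zero ∘ Sum.map₂ (to (linkExp-sem (F oinv)) ∘ to (⋃-sem (linkExp (F oinv)))))
    (Sum.map₂ (from (⋃-sem (linkExp (F oinv))) ∘ from (linkExp-sem (F oinv))) ∘ to pathsVia-zero)
  walkExp-sem (suc m) = mk⇔
    (λ (v , h , h′) → from (pathsVia-suc {k = m}) (v , to (walkExp-sem m) h , to (walkExp-sem m) h′))
    (λ p → let v , p₁ , p₂ = to (pathsVia-suc {k = m}) p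
           in v , from (walkExp-sem m) p₁ , from (walkExp-sem m) p₂)

  walkExp-zero-test : Test 0 (walkExp 0)
  walkExp-zero-test = union-test (atom-test {x = a1'} c-1') (⋃-test (linkExp-test refl))

  walkExp-test : (∀ m (G : Structure n) → pathsF F m G ≡ pathsVia (Link (F oinv) G) m) →
                 ∀ m → Test m (walkExp m)
  walkExp-test walks zero = walkExp-zero-test
  walkExp-test walks (suc m) = comp-test previous previous
    where
    previous : PathTest m (walkExp m)
    previous = walkExp-test walks m ,
               λ h → subst (λ R → R _ _) (sym (walks m _)) (to (walkExp-sem m) h)

  full-at-0 : oneAt0 F ≡ true → Σ (Exp n) λ e → Valid 0 e × (∀ (G : Structure n) s t → ⟦ e ⟧ G s t)
  full-at-0 e₀ with F o1 in x₁ | F o0' in x₂ | F ocompl in x₃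
  ... | true  | _     | _    = `1 , (c-1 x₁ , z≤n) , λ _ _ _ → tt
  ... | false | true  | _    = union `0' `1' , (c-union (c-0' x₂) c-1' , z≤n) , equal-or-not
    where
    equal-or-not : ∀ (G : Structure n) s t → ⟦ union `0' `1' ⟧ G s t
    equal-or-not _ s t with dec (s ≡ t)
    ... | yes s≡t = inj₂ s≡t
    ... | no s≢t = inj₁ s≢t
  ... | false | false | true = compl `0 , (c-compl x₃ c-0 , z≤n) , λ _ _ _ ()
  full-at-0 () | false | false | false

  full-at-1 : oneAt1 F ≡ true → Σ (Exp n) λ e → Valid 1 e × (∀ (G : Structure n) s t → ⟦ e ⟧ G s t)
  full-at-1 e₁ with F olres in x₁ | F orres in x₂
  ... | true  | _    = lres `0 `0 , (c-lres x₁ c-0 c-0 , s≤s z≤n) , λ _ _ _ _ ()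
  ... | false | true = rres `0 `0 , (c-rres x₂ c-0 c-0 , s≤s z≤n) , λ _ _ _ _ ()
  full-at-1 () | false | false

  record PathExpression (m : ℕ) : Set₁ where
    field
      exp  : Exp n
      test : Test m exp
      sem  : ∀ {G : Structure n} {s t} → ⟦ exp ⟧ G s t ⇔ pathsF F m G s t

  full-pathExpression : (e : Exp n) → Valid m e → (∀ (G : Structure n) s t → ⟦ e ⟧ G s t) →
               (∀ (G : Structure n) → pathsF F m G ≡ Full) → PathExpression m
  full-pathExpression e v all full =
    record { exp = e ; test = v , (λ {_} {G₂} {_} {_} {a₂} {b₂} _ _ → all G₂ a₂ b₂)
           ; sem = λ {G} {s} {t} → mk⇔ (λ _ → Full⇒ (full G)) (λ _ → all G s t) }

  walk-pathExpression : (∀ (G : Structure n) → pathsF F m G ≡ pathsVia (Link (F oinv) G) m) →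
                Test m (walkExp m) → PathExpression m
  walk-pathExpression {m} walks t = record
    { exp = walkExp m
    ; test = t
    ; sem = λ {G} {s} {t} →
              subst (λ R → ⟦ walkExp m ⟧ G s t ⇔ R s t) (sym (walks G)) (walkExp-sem m)
    }

  pathExpression : Regime → ∀ m → PathExpression m
  pathExpression (one-at-0 e₀) m =
    let e , v , all = full-at-0 e₀
    in full-pathExpression e (valid-weaken z≤n v) all (pathsF-one-at-0 e₀ m)
  pathExpression (one-at-1 e₀ e₁) zero =
    walk-pathExpression (pathsF-one-at-1-zero e₀ e₁) walkExp-zero-test
  pathExpression (one-at-1 e₀ e₁) (suc m) =
    let e , v , all = full-at-1 e₁
    in full-pathExpression e (valid-weaken (s≤s z≤n) v) all (pathsF-one-at-1-suc e₀ e₁ m)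
  pathExpression (no-one e₀ e₁) m =
    walk-pathExpression (pathsF-no-one e₀ e₁ m) (walkExp-test (pathsF-no-one e₀ e₁) m)

  pathsExp : ℕ → Exp n
  pathsExp m = PathExpression.exp (pathExpression regime m)

  pathsExp-sem : ∀ {G : Structure n} {s t} → ⟦ pathsExp m ⟧ G s t ⇔ pathsF F m G s t
  pathsExp-sem {m} = PathExpression.sem (pathExpression regime m)

  pathsExp-pathTest : PathTest m (pathsExp m)
  pathsExp-pathTest {m} = PathExpression.test (pathExpression regime m) , to (pathsExp-sem {m})

  paths-preserved : ∀ {a₁ b₁ a₂ b₂} → Equivalent G₁ G₂ m a₁ b₁ a₂ b₂ →
                    pathsF F m G₁ a₁ b₁ → pathsF F m G₂ a₂ b₂
  paths-preserved {m = m} z =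
    to (pathsExp-sem {m}) ∘ proj₂ (proj₁ (pathsExp-pathTest {m})) z ∘ from (pathsExp-sem {m})

  compl⇒oneAt0 : ocompl ∈F F → oneAt0 F ≡ true
  compl⇒oneAt0 c = subst (λ b → F o1 ∨ F o0' ∨ b ≡ true) (sym c)
                          (trans (cong (F o1 ∨_) (∨-zeroʳ (F o0'))) (∨-zeroʳ (F o1)))

  relCompl : ocompl ∈F F ⊎ ominus ∈F F → ℕ → Exp n → Exp n
  relCompl (inj₁ _) m e = compl e
  relCompl (inj₂ _) m e = minus (pathsExp m) e

  relCompl-sem : ∀ h m {G : Structure n} {s t} →
                ⟦ relCompl h m e ⟧ G s t ⇔ (pathsF F m G s t × ¬ ⟦ e ⟧ G s t)
  relCompl-sem (inj₁ c) m = mk⇔ (λ ¬h → Full⇒ (pathsF-one-at-0 (compl⇒oneAt0 c) m _) , ¬h) proj₂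
  relCompl-sem (inj₂ _) m =
    mk⇔ (Product.map₁ (to (pathsExp-sem {m}))) (Product.map₁ (from (pathsExp-sem {m})))

  relCompl-pathTest : ∀ h → Test m e → PathTest m (relCompl h m e)
  relCompl-pathTest {m} {e} h ((c , d) , inv) =
    (valid h , invariant) , proj₁ ∘ to (relCompl-sem h m)
    where
    valid : ∀ h → Valid m (relCompl h m e)
    valid (inj₁ o) = c-compl o c , d
    valid (inj₂ o) = let (cₚ , dₚ) , _ = proj₁ (pathsExp-pathTest {m}) in c-minus o cₚ c , ⊔-lub dₚ d
    invariant : Invariant m (relCompl h m e)
    invariant z x = let p , ¬e = to (relCompl-sem h m) x in
      from (relCompl-sem h m) (paths-preserved z p , ¬e ∘ inv (Equivalent-sym z))

  ¬relCompl : ∀ h m {G : Structure n} {s t} →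
             ¬ ⟦ relCompl h m e ⟧ G s t → ¬ pathsF F m G s t ⊎ ⟦ e ⟧ G s t
  ¬relCompl h m ¬x = ¬[×¬]⇒¬⊎ (¬x ∘ from (relCompl-sem h m))

  Agree : List (Exp n) → (G₁ : Structure n) → V G₁ → V G₁ → (G₂ : Structure n) → V G₂ → V G₂ → Set
  Agree D G₁ a₁ b₁ G₂ a₂ b₂ = All (λ e → ⟦ e ⟧ G₁ a₁ b₁ ⇔ ⟦ e ⟧ G₂ a₂ b₂) D

  Equivalent⇒Agree : All (Test m) D → ∀ {G₁ G₂ : Structure n} {a₁ b₁ a₂ b₂} →
                     Equivalent G₁ G₂ m a₁ b₁ a₂ b₂ → Agree D G₁ a₁ b₁ G₂ a₂ b₂
  Equivalent⇒Agree [] z = []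
  Equivalent⇒Agree {D = e ∷ _} ((_ , inv) ∷ tests) z =
    invariant-⇔ {e = e} inv z ∷ Equivalent⇒Agree tests z

  Separating : ℕ → List (Exp n) → Set₁
  Separating m D = All (Test m) D ×
    (∀ {G₁ G₂ : Structure n} {a₁ b₁ a₂ b₂} →
       Agree D G₁ a₁ b₁ G₂ a₂ b₂ → Equivalent G₁ G₂ m a₁ b₁ a₂ b₂)

  record Characterises (m : ℕ) (χ : Exp n) (G : Structure n) (a b : V G) : Set₁ where
    constructor characterises
    field
      characterisation : ∀ (G′ : Structure n) a′ b′ →
                         ⟦ χ ⟧ G′ a′ b′ ⇔ (pathsF F m G′ a′ b′ × Equivalent G G′ m a b a′ b′)

  module _ {G : Structure n} {a b : V G} where

    characterises-self : Characterises m χ G a b → pathsF F m G a b → ⟦ χ ⟧ G a b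
    characterises-self {m} (characterises ch) p = from (ch G a b) (p , Equivalent-refl m G a b)

    characterises-equivalent : Characterises m χ G a b → ∀ {G′ : Structure n} {a′ b′} →
                               ⟦ χ ⟧ G′ a′ b′ → Equivalent G G′ m a b a′ b′
    characterises-equivalent (characterises ch) = proj₂ ∘ to (ch _ _ _)

    characterises-¬relCompl : ∀ h → Characterises m χ G a b → ¬ ⟦ relCompl h m χ ⟧ G a b
    characterises-¬relCompl {m} h ch x =
      let p , ¬χ = to (relCompl-sem h m) x in ¬χ (characterises-self ch p)

  test? : ∀ m → Decidable (Test m)
  test? _ _ = em

  allAtoms : List (AExp n)
  allAtoms = a1' ∷ a0' ∷ map aR (allFin n) ++ map aRinv (allFin n)

  ∈-allAtoms : ∀ x → x ∈ allAtoms
  ∈-allAtoms a1' = here refl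
  ∈-allAtoms a0' = there (here refl)
  ∈-allAtoms (aR R) = there (there (∈-++⁺ˡ (∈-map⁺ aR (∈-allFin R))))
  ∈-allAtoms (aRinv R) = there (there (∈-++⁺ʳ (map aR (allFin n)) (∈-map⁺ aRinv (∈-allFin R))))

  atomTests : List (Exp n)
  atomTests = filter (test? 0) (map toExp allAtoms)

  separating-zero : Separating 0 atomTests
  separating-zero = all-filter (test? 0) _ , λ agree →
    atoms (λ x (c , h) → c , to (agree-on agree x c) h) (λ x (c , h) → c , from (agree-on agree x c) h)
    where
    agree-on : ∀ {G₁ G₂ : Structure n} {a₁ b₁ a₂ b₂} → Agree atomTests G₁ a₁ b₁ G₂ a₂ b₂ →
               ∀ x → InAexp F x → ⟦ toExp x ⟧ G₁ a₁ b₁ ⇔ ⟦ toExp x ⟧ G₂ a₂ b₂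
    agree-on agree x c =
      All.lookup agree (∈-filter⁺ (test? 0) (∈-map⁺ toExp (∈-allAtoms x)) (atom-test c))

  module WithComplement (hyp : ocompl ∈F F ⊎ ominus ∈F F) where

    cubes : ℕ → List (Exp n) → List (Exp n)
    cubes m [] = pathsExp m ∷ []
    cubes m (e ∷ D) = map (inter e) (cubes m D) ++ map (inter (relCompl hyp m e)) (cubes m D)

    cubes-pathTest : All (Test m) D → All (PathTest m) (cubes m D)
    cubes-pathTest [] = pathsExp-pathTest ∷ []
    cubes-pathTest {m} (t ∷ ts) =
      ++⁺ (map⁺ (All.map (inter-pathTest t) (cubes-pathTest ts)))
          (map⁺ (All.map (inter-pathTest (proj₁ (relCompl-pathTest hyp t))) (cubes-pathTest ts)))

    cube-of : ∀ m D (G : Structure n) a b → ∃ λ χ → χ ∈ cubes m D ×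
              (∀ G′ a′ b′ → ⟦ χ ⟧ G′ a′ b′ ⇔ (pathsF F m G′ a′ b′ × Agree D G a b G′ a′ b′))
    cube-of m [] G a b = pathsExp m , here refl , λ _ _ _ →
      mk⇔ (λ h → to (pathsExp-sem {m}) h , []) (from (pathsExp-sem {m}) ∘ proj₁)
    cube-of m (e ∷ D) G a b with dec (⟦ e ⟧ G a b) | cube-of m D G a b
    ... | yes h | χ , χ∈ , sem = inter e χ , ∈-++⁺ˡ (∈-map⁺ (inter e) χ∈) , λ G′ a′ b′ → mk⇔
      (λ (h′ , x) → let p , ag = to (sem G′ a′ b′) x in p , mk⇔ (λ _ → h′) (λ _ → h) ∷ ag)
      (λ { (p , e⇔ ∷ ag) → to e⇔ h , from (sem G′ a′ b′) (p , ag) })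
    ... | no ¬h | χ , χ∈ , sem =
      inter (relCompl hyp m e) χ , ∈-++⁺ʳ (map (inter e) (cubes m D)) (∈-map⁺ _ χ∈) ,
      λ G′ a′ b′ → mk⇔
      (λ (x , y) → let p , ag = to (sem G′ a′ b′) y
                   in p , mk⇔ (⊥-elim ∘ ¬h) (⊥-elim ∘ proj₂ (to (relCompl-sem hyp m) x)) ∷ ag)
      (λ { (p , e⇔ ∷ ag) → from (relCompl-sem hyp m) (p , ¬h ∘ from e⇔) ,
                           from (sem G′ a′ b′) (p , ag) })

    characteristic : Separating m D → ∀ (G : Structure n) a b →
                     ∃ λ χ → χ ∈ cubes m D × Characterises m χ G a b
    characteristic {m} {D} (tests , decides) G a b =
      let χ , χ∈ , sem = cube-of m D G a b
      in χ , χ∈ , characterises λ G′ a′ b′ →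
           ⇔-trans (sem G′ a′ b′) (⇔-refl ×-⇔ mk⇔ decides (Equivalent⇒Agree tests))

    pairTests : ℕ → Exp n → Exp n → List (Exp n)
    pairTests k χ χ′ =
      comp χ χ′ ∷ lres (relCompl hyp k χ) χ′ ∷ rres χ (relCompl hyp k χ′) ∷ proj1 χ ∷ proj2 χ ∷ []

    allPairTests : ℕ → List (Exp n) → List (Exp n)
    allPairTests k L = concatMap (uncurry (pairTests k)) (cartesianProduct L L)

    successorTests : ℕ → List (Exp n) → List (Exp n)
    successorTests k L = filter (test? (suc k)) (allPairTests k L)

    module Successor {k D} (sep : Separating k D) {G₁ G₂ : Structure n} {a₁ b₁ a₂ b₂}
                     (agree : Agree (successorTests k (cubes k D)) G₁ a₁ b₁ G₂ a₂ b₂) where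

      open Conditions F G₁ G₂ (Equivalent G₁ G₂ k) (pathsF F k G₁) (pathsF F k G₂) a₁ b₁ a₂ b₂

      characteristicOf : ∀ (G : Structure n) a b → ∃ λ χ → χ ∈ cubes k D × Characterises k χ G a b
      characteristicOf = characteristic sep

      cube-pathTest : ∀ {χ} → χ ∈ cubes k D → PathTest k χ
      cube-pathTest = All.lookup (cubes-pathTest (proj₁ sep))

      agree-on : ∀ {χ χ′ t} → χ ∈ cubes k D → χ′ ∈ cubes k D → t ∈ pairTests k χ χ′ →
                 Test (suc k) t → ⟦ t ⟧ G₁ a₁ b₁ ⇔ ⟦ t ⟧ G₂ a₂ b₂
      agree-on χ∈ χ′∈ t∈ =
        All.lookup agree ∘ ∈-filter⁺ (test? (suc k))
          (∈-concatMap⁺ (uncurry (pairTests k)) (lose (∈-cartesianProduct⁺ χ∈ χ′∈) t∈))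

      composition : CompForth
      composition c₁ p q =
        let χ , χ∈ , ch = characteristicOf G₁ a₁ c₁
            χ′ , χ′∈ , ch′ = characteristicOf G₁ c₁ b₁
            test = comp-test (cube-pathTest χ∈) (cube-pathTest χ′∈)
            c₂ , h , h′ = to (agree-on χ∈ χ′∈ (here refl) test)
                             (c₁ , characterises-self ch p , characterises-self ch′ q)
        in c₂ , characterises-equivalent ch h , characterises-equivalent ch′ h′

      projection : Equivalent G₁ G₂ k a₁ b₁ a₂ b₂ → oπ ∈F F → ProjForth
      projection z o with dec (a₁ ≡ b₁)
      ... | no a₁≢b₁ = inj₁ a₁≢b₁
      ... | yes a₁≡b₁ = inj₂ (a₁≡b₁ , Equivalent-≡ z a₁≡b₁ , forth , back)
        where
        forth : ∀ c₁ → pathsF F k G₁ a₁ c₁ → ∃ λ c₂ → Equivalent G₁ G₂ k a₁ c₁ a₂ c₂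
        forth c₁ p =
          let χ , χ∈ , ch = characteristicOf G₁ a₁ c₁
              test = proj1-test o (cube-pathTest χ∈)
              _ , c₂ , h = to (agree-on χ∈ χ∈ (there (there (there (here refl)))) test)
                              (a₁≡b₁ , c₁ , characterises-self ch p)
          in c₂ , characterises-equivalent ch h
        back : ∀ c₁ → pathsF F k G₁ c₁ a₁ → ∃ λ c₂ → Equivalent G₁ G₂ k c₁ a₁ c₂ a₂
        back c₁ p =
          let χ , χ∈ , ch = characteristicOf G₁ c₁ a₁
              test = proj2-test o (cube-pathTest χ∈)
              _ , c₂ , h = to (agree-on χ∈ χ∈ (there (there (there (there (here refl))))) test)
                              (a₁≡b₁ , c₁ , characterises-self ch p)
          in c₂ , characterises-equivalent ch h

      -- The test lres (relCompl χ) χ′ fails at (a₁,b₁), witnessed by c₁; a witness of its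
      -- failure at (a₂,b₂) is the required c₂.
      left-residual : olres ∈F F → LResBack
      left-residual o c₁ p =
        let χ , χ∈ , ch = characteristicOf G₁ a₁ c₁
            χ′ , χ′∈ , ch′ = characteristicOf G₁ b₁ c₁
            test = lres-test o (relCompl-pathTest hyp (proj₁ (cube-pathTest χ∈))) (cube-pathTest χ′∈)
            fails : ¬ ⟦ lres (relCompl hyp k χ) χ′ ⟧ G₁ a₁ b₁
            fails h = characterises-¬relCompl hyp ch (h c₁ (characterises-self ch′ p))
            c₂ , h′ , ¬r = ¬∀⇒∃¬ (fails ∘ from (agree-on χ∈ χ′∈ (there (here refl)) test))
        in c₂ , characterises-equivalent ch′ h′ ,
           Sum.map₂ (characterises-equivalent ch) (¬relCompl {e = χ} hyp k ¬r)

      right-residual : orres ∈F F → RResBack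
      right-residual o c₁ p =
        let χ , χ∈ , ch = characteristicOf G₁ c₁ a₁
            χ′ , χ′∈ , ch′ = characteristicOf G₁ c₁ b₁
            test = rres-test o (cube-pathTest χ∈) (relCompl-pathTest hyp (proj₁ (cube-pathTest χ′∈)))
            fails : ¬ ⟦ rres χ (relCompl hyp k χ′) ⟧ G₁ a₁ b₁
            fails h = characterises-¬relCompl hyp ch′ (h c₁ (characterises-self ch p))
            c₂ , h , ¬r = ¬∀⇒∃¬ (fails ∘ from (agree-on χ∈ χ′∈ (there (there (here refl))) test))
        in c₂ , characterises-equivalent ch h ,
           Sum.map₂ (characterises-equivalent ch′) (¬relCompl {e = χ′} hyp k ¬r)

      challenges-from-agreement : Equivalent G₁ G₂ k a₁ b₁ a₂ b₂ →
        Challenges G₁ G₂ (Equivalent G₁ G₂ k) (pathsF F k G₁) (pathsF F k G₂) a₁ b₁ a₂ b₂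
      challenges-from-agreement z = challenges composition (projection z) left-residual right-residual

    separating-suc : Separating k D → Separating (suc k) (D ++ successorTests k (cubes k D))
    separating-suc {k} {D} sep@(tests , decides) =
      ++⁺ (All.map test-suc tests) (all-filter (test? (suc k)) (allPairTests k (cubes k D))) ,
      λ agree → let agreeD , agreeS = ++⁻ D agree
                    z = decides agreeD
                in step z (Successor.challenges-from-agreement sep agreeS z)
                          (Successor.challenges-from-agreement sep (All.map ⇔-sym agreeS) (Equivalent-sym z))

    separating : ∀ m → ∃ (Separating m)
    separating zero = atomTests , separating-zero
    separating (suc k) = _ , separating-suc (proj₂ (separating k))

lemma4p9 : ExcludedMiddle (lsuc 0ℓ) →
    (n : ℕ) (F : Fragment) → (ocompl ∈F F ⊎ ominus ∈F F) →
    (k : ℕ) (G₁ : Structure n) (a₁ b₁ : V G₁) →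
    Σ (Exp n) λ e → InC F e × degree e ≤ k ×
      ((G₂ : Structure n) (a₂ b₂ : V G₂) →
        ⟦ e ⟧ G₂ a₂ b₂ ⇔ (pathsF F k G₂ a₂ b₂ × Bisimilar F G₁ G₂ k a₁ b₁ a₂ b₂))
lemma4p9 em n F hyp k G₁ a₁ b₁ =
  let D , sep = separating k
      χ , χ∈ , characterises ch = characteristic sep G₁ a₁ b₁
      ((c , d) , _) , _ = All.lookup (cubes-pathTest (proj₁ sep)) χ∈
  in χ , c , d , λ G₂ a₂ b₂ → ⇔-trans (ch G₂ a₂ b₂) (⇔-refl ×-⇔ ⇔-sym Bisimilar⇔Equivalent)
  where
  open Characteristic em {n} F
  open WithComplement hyp
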